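{- Let $g$ be a positive integer and $k\le\lfloor g/4\rfloor$ a nonnegative integer. Let $G=(L\cup R,E)$ be a bipartite graph with $n=|L|+|R|$ vertices, $|E|=m\ge n$ edges, and girth at least $g+1$. Then there exist an edge $e\in E$ and $k$ distinct simple paths of length $2k$, each containing $e$, each starting at a vertex of $L$ and ending at a vertex of $L$.
   Context: The girth of a graph is the length of its shortest cycle; the length of a path is its number of edges. -}

module Defs where

open import Data.Nat using (ℕ; zero; suc; _+_; _*_; _≤_)
open import Data.Fin using (Fin)
open import Data.Sum using (_⊎_; inj₁; inj₂)
open import Data.Product using (Σ; _×_; _,_; ∃)
open import Data.Unit using (⊤)
open import Data.List using (List)
open import Data.List.Membership.Propositional using (_∈_)
open import Data.Vec using (Vec; []; _∷_; head; last)
open import Relation.Binary.PropositionalEquality using (_≡_)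
open import Data.Vec.Relation.Unary.Unique.Propositional using (Unique)

-- Edges are given as a list of pairs (l , r) with l ∈ L, r ∈ R; the list
-- is required to be duplicate-free (simple graph), so m = length E.
Vertex : ℕ → ℕ → Set
Vertex a b = Fin a ⊎ Fin b

Edge : ℕ → ℕ → Set
Edge a b = Fin a × Fin b

module _ {a b : ℕ} (E : List (Edge a b)) where

  Adj : Vertex a b → Vertex a b → Set
  Adj u v = Σ (Edge a b) λ { (l , r) → (l , r) ∈ E ×
              ((u ≡ inj₁ l × v ≡ inj₂ r) ⊎ (u ≡ inj₂ r × v ≡ inj₁ l)) }

  IsWalk : ∀ {ℓ} → Vec (Vertex a b) (suc ℓ) → Set
  IsWalk (v ∷ []) = ⊤
  IsWalk (u ∷ v ∷ vs) = Adj u v × IsWalk (v ∷ vs)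

ContainsEdge : ∀ {a b ℓ} → Vec (Vertex a b) (suc ℓ) → Edge a b → Set
ContainsEdge (v ∷ []) e = Data.Empty.⊥
  where import Data.Empty
ContainsEdge (u ∷ v ∷ vs) (l , r) =
  ((u ≡ inj₁ l × v ≡ inj₂ r) ⊎ (u ≡ inj₂ r × v ≡ inj₁ l)) ⊎ ContainsEdge (v ∷ vs) (l , r)

InL : ∀ {a b} → Vertex a b → Set
InL {a} v = ∃ λ (l : Fin a) → v ≡ inj₁ l

IsSimplePath : ∀ {a b ℓ} → List (Edge a b) → Vec (Vertex a b) (suc ℓ) → Set
IsSimplePath E vs = Unique vs × IsWalk E vs

-- a cycle of length ℓ+1 (ℓ+1 ≥ 3): distinct vertices v₀ … v_ℓ, consecutive ones
-- adjacent and v_ℓ adjacent to v₀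
IsCycle : ∀ {a b ℓ} → List (Edge a b) → Vec (Vertex a b) (suc ℓ) → Set
IsCycle {ℓ = ℓ} E vs = 2 ≤ ℓ × Unique vs × IsWalk E vs × Adj E (last vs) (head vs)

GirthAtLeast : ∀ {a b} → List (Edge a b) → ℕ → Set
GirthAtLeast {a} {b} E h =
  ∀ ℓ (vs : Vec (Vertex a b) (suc ℓ)) → IsCycle E vs → h ≤ suc ℓ

{-# OPTIONS --safe #-}
-- Deleting vertices of degree at most one keeps m ≥ n, so some subgraph has minimum degree two,
-- and there a walk that never turns back must close a cycle. By the girth bound the cycle has more
-- than g ≥ 4k edges, so it contains a path v₀ … v_{4k-2} with v₀ ∈ L. The k subpaths
-- v_{2j} … v_{2j+2k} (j < k) start and end in L by parity and all contain the edge v_{2k-2} v_{2k-1};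
-- none equals another or its reverse, since they start at distinct vertices and every start
-- precedes every end.
module Submission where

open import Defs
open import Data.Nat using (ℕ; zero; suc; _+_; _*_; _≤_; _<_; _/_; z≤n; s≤s; z<s; _≤?_)
open import Data.Nat.Properties
  using (≤-refl; ≤-reflexive; ≤-trans; <⇒≤; ≤-pred; <⇒≢; <⇒≱; ≰⇒>; n≤1+n; n<1+n; m≤m+n; m≤n+m; m<m+n;
         suc-injective; +-suc; +-identityʳ; +-monoˡ-≤; *-suc; *-distribˡ-+; *-monoˡ-≤; *-monoʳ-≤; *-monoʳ-<;
         *-cancelˡ-≡; m≤n⇒m<n∨m≡n; anyUpTo?; module ≤-Reasoning)
open import Data.Nat.DivMod using (m/n*n≤m)
open import Data.Nat.Induction using (<-wellFounded)
open import Induction.WellFounded using (Acc; acc)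
open import Data.Nat.Tactic.RingSolver using (solve-∀)
open import Data.Fin using (Fin; toℕ; splitAt; join)
import Data.Fin.Properties as Fin
open import Data.Sum using (_⊎_; inj₁; inj₂)
import Data.Sum.Properties as Sum
open import Data.Product using (Σ; ∃; ∃₂; _×_; _,_; proj₁; proj₂)
open import Data.Unit using (tt)
open import Data.Empty using (⊥-elim)
open import Data.List using (List; []; _∷_; length; filter; tabulate)
open import Data.List.Properties using (length-tabulate; filter-notAll)
open import Data.List.Membership.Propositional using (_∈_; find)
open import Data.List.Membership.Propositional.Properties using (∈-filter⁻; ∈-filter⁺; ∈-tabulate⁺; ∈-length)
open import Data.List.Relation.Unary.Any as Any using (here; there)
open import Data.List.Relation.Unary.All as All using (_∷_)
open import Data.List.Relation.Unary.All.Properties using (¬Any⇒All¬)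
open import Data.List.Relation.Unary.AllPairs using (_∷_)
open import Data.List.Relation.Binary.Subset.Propositional using (_⊆_)
open import Data.List.Relation.Unary.Unique.Propositional using (Unique)
import Data.List.Relation.Unary.Unique.Propositional.Properties as Unique
open import Data.Vec using (Vec; []; _∷_; head; last; reverse)
open import Data.Vec.Properties using (last-reverse; reverse-involutive)
open import Data.Vec.Relation.Unary.All using ([]; _∷_) renaming (All to AllV)
open import Data.Vec.Relation.Unary.AllPairs using ([]; _∷_)
open import Function using (_∘_)
open import Relation.Binary.PropositionalEquality
  using (_≡_; _≢_; refl; sym; trans; cong; subst; subst₂; module ≡-Reasoning)
open import Relation.Nullary using (Dec; yes; no; ¬_; ¬?)
open import Relation.Nullary.Decidable using (_⊎-dec_)
open import Relation.Unary using (Decidable)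
open import Relation.Unary.Properties using (∁?)

module _ {A : Set} where

  0<length⇒∃∈ : ∀ {xs : List A} → 0 < length xs → ∃ (_∈ xs)
  0<length⇒∃∈ {x ∷ _} _ = x , here refl

  twoDistinct : ∀ {xs : List A} → Unique xs → 2 ≤ length xs → ∃₂ λ x y → x ∈ xs × y ∈ xs × x ≢ y
  twoDistinct {x ∷ y ∷ _} ((x≢y ∷ _) ∷ _) _ = x , y , here refl , there (here refl) , x≢y
  twoDistinct {_ ∷ []} _ (s≤s ())

  index≥2 : ∀ {x} (f : ℕ → A) {t} → x ≢ f 0 → x ≢ f 1 → x ≡ f t → 2 ≤ t
  index≥2 f {zero}        x≢f₀ _    x≡f₀ = ⊥-elim (x≢f₀ x≡f₀)
  index≥2 f {suc zero}    _    x≢f₁ x≡f₁ = ⊥-elim (x≢f₁ x≡f₁)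
  index≥2 f {suc (suc t)} _    _    _    = s≤s (s≤s z≤n)

  length-filter+length-filter-∁ : ∀ {P : A → Set} (P? : Decidable P) xs →
    length (filter P? xs) + length (filter (∁? P?) xs) ≡ length xs
  length-filter+length-filter-∁ P? [] = refl
  length-filter+length-filter-∁ P? (x ∷ xs) with P? x
  ... | yes _ = cong suc (length-filter+length-filter-∁ P? xs)
  ... | no _  = trans (+-suc _ _) (cong suc (length-filter+length-filter-∁ P? xs))

  head-reverse : ∀ {n} (xs : Vec A (suc n)) → head (reverse xs) ≡ last xs
  head-reverse xs = trans (sym (last-reverse (reverse xs))) (cong last (reverse-involutive xs))

  segment : (ℕ → A) → ℕ → (n : ℕ) → Vec A (suc n)
  segment f s zero    = f s ∷ []
  segment f s (suc n) = f s ∷ segment f (suc s) n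

  segment-head : ∀ f s n → head (segment f s n) ≡ f s
  segment-head f s zero    = refl
  segment-head f s (suc n) = refl

  segment-last : ∀ f s n → last (segment f s n) ≡ f (s + n)
  segment-last f s zero    = cong f (sym (+-identityʳ s))
  segment-last f s (suc n) = trans (segment-last f (suc s) n) (cong f (sym (+-suc s n)))

  segment-All : ∀ {P : A → Set} f s n → (∀ {t} → s ≤ t → t ≤ s + n → P (f t)) → AllV P (segment f s n)
  segment-All f s zero    P-on = P-on ≤-refl (m≤m+n s 0) ∷ []
  segment-All f s (suc n) P-on =
    P-on ≤-refl (m≤m+n s _) ∷
    segment-All f (suc s) n (λ s<t t≤ → P-on (<⇒≤ s<t) (≤-trans t≤ (≤-reflexive (sym (+-suc s n)))))

module _ {a b : ℕ} where

  private variable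
    E F : List (Edge a b)
    S : List (Vertex a b)
    u v w : Vertex a b
    l : Fin a
    r : Fin b
    ℓ m : ℕ

  _≟_ : (u v : Vertex a b) → Dec (u ≡ v)
  _≟_ = Sum.≡-dec Fin._≟_ Fin._≟_

  Adj-sym : Adj E u v → Adj E v u
  Adj-sym (e , e∈E , inj₁ (u≡ , v≡)) = e , e∈E , inj₂ (v≡ , u≡)
  Adj-sym (e , e∈E , inj₂ (u≡ , v≡)) = e , e∈E , inj₁ (v≡ , u≡)

  Adj-irrefl : ¬ Adj E v v
  Adj-irrefl (_ , _ , inj₁ (refl , ()))
  Adj-irrefl (_ , _ , inj₂ (refl , ()))

  Adj-mono : E ⊆ F → Adj E u v → Adj F u v
  Adj-mono E⊆F (e , e∈E , ends) = e , E⊆F e∈E , ends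

  Adj-fromInL : InL u → Adj E u v → ∃₂ λ l r → u ≡ inj₁ l × v ≡ inj₂ r × (l , r) ∈ E
  Adj-fromInL (_ , refl) (_ , lr∈E , inj₁ (u≡ , v≡)) = _ , _ , u≡ , v≡ , lr∈E

  Adj-fromR : Adj E (inj₂ r) v → InL v
  Adj-fromR (_ , _ , inj₂ (refl , v≡)) = _ , v≡

  InL-two-steps : InL u → Adj E u v → Adj E v w → InL w
  InL-two-steps u∈L u~v v~w with _ , _ , _ , refl , _ ← Adj-fromInL u∈L u~v = Adj-fromR v~w

  -- The vertices of a path of length ℓ are vertex 0, …, vertex ℓ; the values beyond ℓ are irrelevant.
  record Path (E : List (Edge a b)) (ℓ : ℕ) : Set where
    field
      vertex    : ℕ → Vertex a b
      adjacent  : ∀ {t} → t < ℓ → Adj E (vertex t) (vertex (suc t))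
      injective : ∀ {s t} → s ≤ ℓ → t ≤ ℓ → vertex s ≡ vertex t → s ≡ t

  open Path

  Path-mono : E ⊆ F → Path E ℓ → Path F ℓ
  vertex    (Path-mono E⊆F P) = vertex P
  adjacent  (Path-mono E⊆F P) t<ℓ = Adj-mono E⊆F (adjacent P t<ℓ)
  injective (Path-mono E⊆F P) = injective P

  prefix : m ≤ ℓ → Path E ℓ → Path E m
  vertex    (prefix m≤ℓ P) = vertex P
  adjacent  (prefix m≤ℓ P) t<m = adjacent P (≤-trans t<m m≤ℓ)
  injective (prefix m≤ℓ P) s≤m t≤m = injective P (≤-trans s≤m m≤ℓ) (≤-trans t≤m m≤ℓ)

  tail : Path E (suc ℓ) → Path E ℓ
  vertex    (tail P) = vertex P ∘ suc
  adjacent  (tail P) t<ℓ = adjacent P (s≤s t<ℓ)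
  injective (tail P) s≤ℓ t≤ℓ eq = suc-injective (injective P (s≤s s≤ℓ) (s≤s t≤ℓ) eq)

  trivial : Vertex a b → Path E 0
  vertex    (trivial v) _ = v
  adjacent  (trivial v) ()
  injective (trivial v) z≤n z≤n _ = refl

  prepend : ∀ w (P : Path E ℓ) → Adj E w (vertex P 0) → (∀ {t} → t ≤ ℓ → w ≢ vertex P t) → Path E (suc ℓ)
  vertex    (prepend w P _ _) zero    = w
  vertex    (prepend w P _ _) (suc t) = vertex P t
  adjacent  (prepend w P w~P₀ _) {zero}  _         = w~P₀
  adjacent  (prepend w P _ _)    {suc t} (s≤s t<ℓ) = adjacent P t<ℓ
  injective (prepend w P _ _)     {zero}  {zero}  _         _         _  = refl
  injective (prepend w P _ fresh) {zero}  {suc t} _         (s≤s t≤ℓ) eq = ⊥-elim (fresh t≤ℓ eq)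
  injective (prepend w P _ fresh) {suc s} {zero}  (s≤s s≤ℓ) _         eq = ⊥-elim (fresh s≤ℓ (sym eq))
  injective (prepend w P _ _)     {suc s} {suc t} (s≤s s≤ℓ) (s≤s t≤ℓ) eq = cong suc (injective P s≤ℓ t≤ℓ eq)

  edgePath : (l , r) ∈ E → Path E 1
  edgePath lr∈E = prepend _ (trivial _) (_ , lr∈E , inj₁ (refl , refl)) λ _ ()

  join-injective : ∀ {u v : Vertex a b} → join a b u ≡ join a b v → u ≡ v
  join-injective {u} {v} eq =
    trans (sym (Fin.splitAt-join a b u)) (trans (cong (splitAt a) eq) (Fin.splitAt-join a b v))

  length<vertexCount : Path E ℓ → ℓ < a + b
  length<vertexCount P = Fin.injective⇒≤ λ {i} {j} eq →
    Fin.toℕ-injective (injective P (Fin.toℕ≤pred[n] i) (Fin.toℕ≤pred[n] j) (join-injective eq))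

  IsWalk-∷ : ∀ {n} {xs : Vec (Vertex a b) (suc n)} → Adj E v (head xs) → IsWalk E xs → IsWalk E (v ∷ xs)
  IsWalk-∷ {xs = _ ∷ _} v~x₀ walk = v~x₀ , walk

  segment-isSimplePath : (P : Path E ℓ) → ∀ s n → s + n ≤ ℓ → IsSimplePath E (segment (vertex P) s n)
  segment-isSimplePath P s zero    _    = ([] ∷ []) , tt
  segment-isSimplePath {E = E} {ℓ = ℓ} P s (suc n) fits =
    (segment-All (vertex P) (suc s) n fresh ∷ proj₁ rest) , IsWalk-∷ firstStep (proj₂ rest)
    where
      fits′ : suc s + n ≤ ℓ
      fits′ = subst (_≤ ℓ) (+-suc s n) fits
      rest = segment-isSimplePath P (suc s) n fits′
      fresh : ∀ {t} → suc s ≤ t → t ≤ suc s + n → vertex P s ≢ vertex P t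
      fresh s<t t≤ = <⇒≢ s<t ∘ injective P (<⇒≤ (≤-trans (s≤s (m≤m+n s n)) fits′)) (≤-trans t≤ fits′)
      firstStep : Adj E (vertex P s) (head (segment (vertex P) (suc s) n))
      firstStep = subst (Adj E (vertex P s)) (sym (segment-head (vertex P) (suc s) n))
                        (adjacent P (≤-trans (s≤s (m≤m+n s n)) fits′))

  ContainsEdge-∷ : ∀ {n} {xs : Vec (Vertex a b) (suc n)} {e} → ContainsEdge xs e → ContainsEdge (v ∷ xs) e
  ContainsEdge-∷ {xs = _ ∷ _} = inj₂

  ContainsEdge-head : ∀ {n} {xs : Vec (Vertex a b) (suc n)} →
                      v ≡ inj₁ l → head xs ≡ inj₂ r → ContainsEdge (v ∷ xs) (l , r)
  ContainsEdge-head {xs = _ ∷ _} v≡l x₀≡r = inj₁ (inj₁ (v≡l , x₀≡r))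

  segment-containsEdge : ∀ (f : ℕ → Vertex a b) s n {t} → s ≤ t → t < s + n →
                         f t ≡ inj₁ l → f (suc t) ≡ inj₂ r → ContainsEdge (segment f s n) (l , r)
  segment-containsEdge f s zero s≤t t<s+0 _ _ = ⊥-elim (<⇒≱ t<s+0 (subst (_≤ _) (sym (+-identityʳ s)) s≤t))
  segment-containsEdge f s (suc n) s≤t t<s+1+n ft≡l ft+1≡r with m≤n⇒m<n∨m≡n s≤t
  ... | inj₂ refl = ContainsEdge-head ft≡l (trans (segment-head f (suc s) n) ft+1≡r)
  ... | inj₁ s<t  = ContainsEdge-∷
    (segment-containsEdge f (suc s) n s<t (≤-trans t<s+1+n (≤-reflexive (+-suc s n))) ft≡l ft+1≡r)

  record Cycle (E : List (Edge a b)) : Set where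
    field
      pathLength : ℕ
      path       : Path E pathLength
      2≤length   : 2 ≤ pathLength
      closing    : Adj E (vertex path pathLength) (vertex path 0)

  Cycle-mono : E ⊆ F → Cycle E → Cycle F
  Cycle-mono E⊆F C = record
    { pathLength = pathLength
    ; path       = Path-mono E⊆F path
    ; 2≤length   = 2≤length
    ; closing    = Adj-mono E⊆F closing
    }
    where open Cycle C

  girth≤length : ∀ {h} → GirthAtLeast E h → (C : Cycle E) → h ≤ suc (Cycle.pathLength C)
  girth≤length {E = E} girth C =
    girth pathLength cycle (2≤length , proj₁ simple , proj₂ simple , closing′)
    where
      open Cycle C
      cycle = segment (vertex path) 0 pathLength
      simple = segment-isSimplePath path 0 pathLength ≤-refl
      closing′ : Adj E (last cycle) (head cycle)
      closing′ = subst₂ (Adj E) (sym (segment-last (vertex path) 0 pathLength))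
                                (sym (segment-head (vertex path) 0 pathLength)) closing

  Incident : Vertex a b → Edge a b → Set
  Incident v (l , r) = v ≡ inj₁ l ⊎ v ≡ inj₂ r

  Incident? : ∀ v e → Dec (Incident v e)
  Incident? v (l , r) = (v ≟ inj₁ l) ⊎-dec (v ≟ inj₂ r)

  degree : List (Edge a b) → Vertex a b → ℕ
  degree F v = length (filter (Incident? v) F)

  otherEnd : ∀ e → Incident v e → Vertex a b
  otherEnd (l , r) (inj₁ _) = inj₂ r
  otherEnd (l , r) (inj₂ _) = inj₁ l

  Adj-otherEnd : ∀ {e} → e ∈ F → (v∈e : Incident v e) → Adj F v (otherEnd e v∈e)
  Adj-otherEnd e∈F (inj₁ v≡l) = _ , e∈F , inj₁ (v≡l , refl)
  Adj-otherEnd e∈F (inj₂ v≡r) = _ , e∈F , inj₂ (v≡r , refl)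

  otherEnd-injective : ∀ e₁ e₂ (v∈e₁ : Incident v e₁) (v∈e₂ : Incident v e₂) →
                       otherEnd e₁ v∈e₁ ≡ otherEnd e₂ v∈e₂ → e₁ ≡ e₂
  otherEnd-injective _ _ (inj₁ refl) (inj₁ refl) refl = refl
  otherEnd-injective _ _ (inj₂ refl) (inj₂ refl) refl = refl
  otherEnd-injective _ _ (inj₁ refl) (inj₂ ())   _
  otherEnd-injective _ _ (inj₂ refl) (inj₁ ())   _

  -- Two distinct edges at v have distinct other ends, and at most one of them is p.
  anotherNeighbour : Unique F → 2 ≤ degree F v → ∀ p → ∃ λ w → Adj F v w × w ≢ p
  anotherNeighbour {v = v} F-unique 2≤deg p
    with e₁ , e₂ , e₁∈ , e₂∈ , e₁≢e₂ ← twoDistinct (Unique.filter⁺ (Incident? v) F-unique) 2≤deg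
    with e₁∈F , v∈e₁ ← ∈-filter⁻ (Incident? v) e₁∈
    with e₂∈F , v∈e₂ ← ∈-filter⁻ (Incident? v) e₂∈
    with otherEnd e₁ v∈e₁ ≟ p
  ... | no  w₁≢p = _ , Adj-otherEnd e₁∈F v∈e₁ , w₁≢p
  ... | yes w₁≡p = _ , Adj-otherEnd e₂∈F v∈e₂ ,
                   λ w₂≡p → e₁≢e₂ (otherEnd-injective e₁ e₂ v∈e₁ v∈e₂ (trans w₁≡p (sym w₂≡p)))

  Covers : List (Vertex a b) → List (Edge a b) → Set
  Covers S F = ∀ {l r} → (l , r) ∈ F → inj₁ l ∈ S × inj₂ r ∈ S

  Covers-Adj : Covers S F → Adj F u v → v ∈ S
  Covers-Adj S-covers (_ , lr∈F , inj₁ (_ , refl)) = proj₂ (S-covers lr∈F)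
  Covers-Adj S-covers (_ , lr∈F , inj₂ (_ , refl)) = proj₁ (S-covers lr∈F)

  module _ (F-unique : Unique F) (S-covers : Covers S F) (minDegree : ∀ {v} → v ∈ S → 2 ≤ degree F v) where

    -- The first new neighbour of the start that already lies on the path closes a cycle; a path has fewer
    -- than a + b edges, so a + b prolongations are enough fuel.
    extend : ∀ fuel → a + b ≤ fuel + ℓ → (P : Path F (suc ℓ)) → vertex P 0 ∈ S → Cycle F
    extend {ℓ} zero n≤ℓ P _ = ⊥-elim (<⇒≱ (length<vertexCount P) (≤-trans n≤ℓ (n≤1+n ℓ)))
    extend {ℓ} (suc fuel) n≤ P P₀∈S
      with w , P₀~w , w≢P₁ ← anotherNeighbour F-unique (minDegree P₀∈S) (vertex P 1)
      with anyUpTo? (λ t → w ≟ vertex P t) (2 + ℓ)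
    ... | yes (t , t<2+ℓ , w≡Pₜ) = record
      { pathLength = t
      ; path       = prefix (≤-pred t<2+ℓ) P
      ; 2≤length   = index≥2 (vertex P) (λ w≡P₀ → Adj-irrefl (subst (Adj F (vertex P 0)) w≡P₀ P₀~w)) w≢P₁ w≡Pₜ
      ; closing    = subst (λ x → Adj F x (vertex P 0)) w≡Pₜ (Adj-sym P₀~w)
      }
    ... | no w∉P = extend fuel (≤-trans n≤ (≤-reflexive (sym (+-suc fuel ℓ))))
                     (prepend w P (Adj-sym P₀~w) λ t≤ w≡Pₜ → w∉P (_ , s≤s t≤ , w≡Pₜ))
                     (Covers-Adj S-covers P₀~w)

    minDegree⇒cycle : (l , r) ∈ F → Cycle F
    minDegree⇒cycle lr∈F = extend (a + b) (m≤m+n (a + b) 0) (edgePath lr∈F) (proj₁ (S-covers lr∈F))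

  deleteVertex : Vertex a b → List (Vertex a b) → List (Vertex a b)
  deleteVertex v = filter (λ u → ¬? (u ≟ v))

  deleteIncident : Vertex a b → List (Edge a b) → List (Edge a b)
  deleteIncident v = filter (∁? (Incident? v))

  deleteIncident-⊆ : deleteIncident v F ⊆ F
  deleteIncident-⊆ {v = v} = proj₁ ∘ ∈-filter⁻ (∁? (Incident? v))

  length-deleteVertex : v ∈ S → length (deleteVertex v S) < length S
  length-deleteVertex {S = S} v∈S = filter-notAll _ S (Any.map (λ v≡u u≢v → u≢v (sym v≡u)) v∈S)

  length-deleteIncident : ∀ F v → length F ≡ degree F v + length (deleteIncident v F)
  length-deleteIncident F v = sym (length-filter+length-filter-∁ (Incident? v) F)

  Covers-delete : Covers S F → Covers (deleteVertex v S) (deleteIncident v F)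
  Covers-delete {v = v} S-covers lr∈F′ with lr∈F , v∉lr ← ∈-filter⁻ (∁? (Incident? v)) lr∈F′ =
    ∈-filter⁺ _ (proj₁ (S-covers lr∈F)) (v∉lr ∘ inj₁ ∘ sym) ,
    ∈-filter⁺ _ (proj₂ (S-covers lr∈F)) (v∉lr ∘ inj₂ ∘ sym)

  -- The two ends of an edge are distinct, so at least one of them survives.
  deleteVertex-nonempty : Covers S F → (l , r) ∈ F → 0 < length (deleteVertex v S)
  deleteVertex-nonempty {l = l} {v = v} S-covers lr∈F with inj₁ l ≟ v
  ... | no  l≢v  = ∈-length (∈-filter⁺ _ (proj₁ (S-covers lr∈F)) l≢v)
  ... | yes refl = ∈-length (∈-filter⁺ _ (proj₂ (S-covers lr∈F)) λ ())

  -- Deleting a vertex of degree at most one keeps |S| ≤ |F|; when there is none, the minimum degree is two.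
  dense⇒cycle : Acc _<_ (length S) → Unique S → Unique F → Covers S F →
                   0 < length S → length S ≤ length F → Cycle F
  dense⇒cycle {S = S} {F = F} (acc smaller) S-unique F-unique S-covers 0<|S| |S|≤|F|
    with _ , e∈F ← 0<length⇒∃∈ (≤-trans 0<|S| |S|≤|F|)
    with Any.any? (λ v → degree F v ≤? 1) S
  ... | no noLeaf = minDegree⇒cycle F-unique S-covers (≰⇒> ∘ All.lookup (¬Any⇒All¬ S noLeaf)) e∈F
  ... | yes leaf with v , v∈S , deg≤1 ← find leaf =
    Cycle-mono deleteIncident-⊆
      (dense⇒cycle (smaller (length-deleteVertex v∈S)) (Unique.filter⁺ _ S-unique) (Unique.filter⁺ _ F-unique)
                      (Covers-delete S-covers) (deleteVertex-nonempty S-covers e∈F) |S′|≤|F′|)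
    where
      open ≤-Reasoning
      |S′|≤|F′| : length (deleteVertex v S) ≤ length (deleteIncident v F)
      |S′|≤|F′| = ≤-pred (begin
        suc (length (deleteVertex v S))           ≤⟨ length-deleteVertex v∈S ⟩
        length S                                  ≤⟨ |S|≤|F| ⟩
        length F                                  ≡⟨ length-deleteIncident F v ⟩
        degree F v + length (deleteIncident v F)  ≤⟨ +-monoˡ-≤ _ deg≤1 ⟩
        suc (length (deleteIncident v F))         ∎)

  allVertices : List (Vertex a b)
  allVertices = tabulate (splitAt a)

  ∈-allVertices : ∀ v → v ∈ allVertices
  ∈-allVertices v = subst (_∈ allVertices) (Fin.splitAt-join a b v) (∈-tabulate⁺ (join a b v))

  allVertices-unique : Unique allVertices
  allVertices-unique = Unique.tabulate⁺ λ {i} {j} eq →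
    trans (sym (Fin.join-splitAt a b i)) (trans (cong (join a b) eq) (Fin.join-splitAt a b j))

  n≤m⇒cycle : Unique E → 0 < a + b → a + b ≤ length E → Cycle E
  n≤m⇒cycle {E = E} E-unique 0<n n≤m =
    dense⇒cycle (<-wellFounded _) allVertices-unique E-unique (λ _ → ∈-allVertices _ , ∈-allVertices _)
      (subst (0 <_) (sym length-allVertices) 0<n) (subst (_≤ length E) (sym length-allVertices) n≤m)
    where
      length-allVertices : length allVertices ≡ a + b
      length-allVertices = length-tabulate (splitAt a)

  InL-even : (P : Path E ℓ) → InL (vertex P 0) → ∀ m → 2 * m ≤ ℓ → InL (vertex P (2 * m))
  InL-even P P₀∈L zero    _ = P₀∈L
  InL-even P P₀∈L (suc m) 2m+2≤ℓ rewrite *-suc 2 m =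
    InL-two-steps (InL-even P P₀∈L m (<⇒≤ (<⇒≤ 2m+2≤ℓ))) (adjacent P (<⇒≤ 2m+2≤ℓ)) (adjacent P 2m+2≤ℓ)

  pathFromL : Path E (suc ℓ) → Σ (Path E ℓ) λ Q → InL (vertex Q 0)
  pathFromL {E = E} P with vertex P 0 in P₀≡
  ... | inj₁ l = prefix (n≤1+n _) P , l , P₀≡
  ... | inj₂ r = tail P , Adj-fromR (subst (λ v → Adj E v (vertex P 1)) P₀≡ (adjacent P z<s))

  segment-endsInL : (P : Path E ℓ) → InL (vertex P 0) → ∀ i n → 2 * i + 2 * n ≤ ℓ →
                    InL (head (segment (vertex P) (2 * i) (2 * n))) ×
                    InL (last (segment (vertex P) (2 * i) (2 * n)))
  segment-endsInL P P₀∈L i n fits =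
    subst InL (sym (segment-head (vertex P) (2 * i) (2 * n))) (InL-even P P₀∈L i (≤-trans (m≤m+n _ _) fits)) ,
    subst InL (sym (segment-last (vertex P) (2 * i) (2 * n)))
      (subst (InL ∘ vertex P) (*-distribˡ-+ 2 i n)
        (InL-even P P₀∈L (i + n) (≤-trans (≤-reflexive (*-distribˡ-+ 2 i n)) fits)))

  segment-≢ : (P : Path E ℓ) → ∀ {s s′} n → s ≤ ℓ → s′ ≤ ℓ → s ≢ s′ →
              segment (vertex P) s n ≢ segment (vertex P) s′ n
  segment-≢ P {s} {s′} n s≤ℓ s′≤ℓ s≢s′ eq = s≢s′ (injective P s≤ℓ s′≤ℓ (begin
    vertex P s                      ≡⟨ segment-head (vertex P) s n ⟨
    head (segment (vertex P) s n)   ≡⟨ cong head eq ⟩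
    head (segment (vertex P) s′ n)  ≡⟨ segment-head (vertex P) s′ n ⟩
    vertex P s′                     ∎))
    where open ≡-Reasoning

  segment-≢-reverse : (P : Path E ℓ) → ∀ {s s′} n → s ≤ ℓ → s′ + n ≤ ℓ → s < s′ + n →
                      segment (vertex P) s n ≢ reverse (segment (vertex P) s′ n)
  segment-≢-reverse P {s} {s′} n s≤ℓ s′+n≤ℓ s<s′+n eq = <⇒≢ s<s′+n (injective P s≤ℓ s′+n≤ℓ (begin
    vertex P s                                ≡⟨ segment-head (vertex P) s n ⟨
    head (segment (vertex P) s n)             ≡⟨ cong head eq ⟩
    head (reverse (segment (vertex P) s′ n))  ≡⟨ head-reverse (segment (vertex P) s′ n) ⟩
    last (segment (vertex P) s′ n)            ≡⟨ segment-last (vertex P) s′ n ⟩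
    vertex P (s′ + n)                         ∎))
    where open ≡-Reasoning

  SharedEdgePaths : List (Edge a b) → (k : ℕ) → Edge a b → Set
  SharedEdgePaths E k e =
    Σ (Fin k → Vec (Vertex a b) (suc (2 * k))) λ P →
      (∀ i → IsSimplePath E (P i) × ContainsEdge (P i) e × InL (head (P i)) × InL (last (P i))) ×
      (∀ i j → i ≢ j → P i ≢ P j × P i ≢ reverse (P j))

  -- The j-th path runs from vertex 2j to vertex 2j + 2(k + 1) of P, so every one of them
  -- passes through the edge from vertex 2k to vertex 2k + 1.
  sharedEdgePaths : ∀ k (P : Path E (2 * k + 2 * suc k)) → InL (vertex P 0) →
                    Σ (Edge a b) λ e → e ∈ E × SharedEdgePaths E (suc k) e
  sharedEdgePaths {E = E} k P P₀∈L
    with l , r , f2k≡l , f2k+1≡r , lr∈E ←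
           Adj-fromInL (InL-even P P₀∈L k (m≤m+n _ _)) (adjacent P (m<m+n (2 * k) z<s))
    = (l , r) , lr∈E , segments , properties , distinct
    where
      K = suc k
      f = vertex P

      start : Fin K → ℕ
      start j = 2 * toℕ j

      segments : Fin K → Vec (Vertex a b) (suc (2 * K))
      segments j = segment f (start j) (2 * K)

      fits : ∀ j → start j + 2 * K ≤ 2 * k + 2 * K
      fits j = +-monoˡ-≤ (2 * K) (*-monoʳ-≤ 2 (Fin.toℕ≤pred[n] j))

      start≤ : ∀ j → start j ≤ 2 * k + 2 * K
      start≤ j = ≤-trans (m≤m+n _ _) (fits j)

      below-end : ∀ {t} j → t < K → 2 * t < start j + 2 * K
      below-end j t<K = ≤-trans (*-monoʳ-< 2 t<K) (m≤n+m _ _)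

      properties : ∀ j → IsSimplePath E (segments j) × ContainsEdge (segments j) (l , r) ×
                         InL (head (segments j)) × InL (last (segments j))
      properties j =
        segment-isSimplePath P (start j) (2 * K) (fits j) ,
        segment-containsEdge f (start j) (2 * K) (*-monoʳ-≤ 2 (Fin.toℕ≤pred[n] j)) (below-end j (n<1+n k))
                             f2k≡l f2k+1≡r ,
        segment-endsInL P P₀∈L (toℕ j) K (fits j)

      distinct : ∀ i j → i ≢ j → segments i ≢ segments j × segments i ≢ reverse (segments j)
      distinct i j i≢j =
        segment-≢ P (2 * K) (start≤ i) (start≤ j) (i≢j ∘ Fin.toℕ-injective ∘ *-cancelˡ-≡ _ _ 2) ,
        segment-≢-reverse P (2 * K) (start≤ i) (fits j) (below-end j (Fin.toℕ<n i))

mainTheorem11 : (g k a b : ℕ) → 1 ≤ g → k ≤ g / 4 →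
    (E : List (Edge a b)) → Unique E →
    1 ≤ a + b → a + b ≤ length E → GirthAtLeast E (g + 1) →
    Σ (Edge a b) λ e → e ∈ E ×
      Σ (Fin k → Vec (Vertex a b) (suc (2 * k))) λ P →
        (∀ i → IsSimplePath E (P i) × ContainsEdge (P i) e ×
               InL (head (P i)) × InL (last (P i))) ×
        (∀ i j → i ≢ j → P i ≢ P j × P i ≢ reverse (P j))
mainTheorem11 g zero a b _ _ E _ 1≤n n≤m _ =
  let e , e∈E = 0<length⇒∃∈ (≤-trans 1≤n n≤m) in e , e∈E , (λ ()) , (λ ()) , λ ()
mainTheorem11 g (suc k) a b _ k<g/4 E E-unique 1≤n n≤m girth =
  let Q , Q₀∈L = pathFromL (prefix long (Cycle.path C)) in sharedEdgePaths k Q Q₀∈L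
  where
    C = n≤m⇒cycle E-unique 1≤n n≤m
    open ≤-Reasoning
    2+[2k+2[1+k]]≡[1+k]*4 : ∀ k → 2 + (2 * k + 2 * suc k) ≡ suc k * 4
    2+[2k+2[1+k]]≡[1+k]*4 = solve-∀
    long : suc (2 * k + 2 * suc k) ≤ Cycle.pathLength C
    long = ≤-pred (begin
      2 + (2 * k + 2 * suc k)   ≡⟨ 2+[2k+2[1+k]]≡[1+k]*4 k ⟩
      suc k * 4                 ≤⟨ *-monoˡ-≤ 4 k<g/4 ⟩
      g / 4 * 4                 ≤⟨ m/n*n≤m g 4 ⟩
      g                         ≤⟨ m≤m+n g 1 ⟩
      g + 1                     ≤⟨ girth≤length girth C ⟩
      suc (Cycle.pathLength C)  ∎)
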